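{- For every integer $k\ge2$, \[ \{0\}=\rho_{k-2}(\check{\mathfrak{H}}_1^1)\subset\rho_{k-3}(\check{\mathfrak{H}}_2^1)\subset\cdots\subset\rho_0(\check{\mathfrak{H}}_{k-1}^1)=\rho(\check{\mathfrak{H}}_{k-1}^1). \]
   Context: Let $\mathfrak{H}=\mathbb{Q}\langle x,y\rangle$ be the noncommutative polynomial algebra over $\mathbb{Q}$ in $x,y$; $z=x+y$, $z_k=x^{k-1}y$ ($k\ge1$). For $k\ge1$, $\check{\mathfrak{H}}_k^1$ is the $\mathbb{Q}$-span of all monomials $z_{k_1}\cdots z_{k_l}$ with $l\ge1$, $k_i\ge1$, $k_1+\dots+k_l=k$, not all $k_i=1$; $\check{\mathfrak{H}}^1=\sum_{k}\check{\mathfrak{H}}_k^1$. For a tuple $(k_1,\dots,k_l)$ extend indices cyclically modulo $l$ and define the $\mathbb{Q}$-linear map $\rho\colon\check{\mathfrak{H}}^1\to\mathfrak{H}$ by $\rho(z_{k_1}\cdots z_{k_l})=\sum_{j=1}^{l}\sum_{i=1}^{k_j-1}z_{k_j-i+1}z_{k_{j+1}}\cdots z_{k_{j+l-1}}z_i-\sum_{j=1}^{l}z_{k_j+1}z_{k_{j+1}}\cdots z_{k_{j+l-1}}$. For $n\ge0$, make $\mathfrak{H}^{\otimes(n+2)}$ an $\mathfrak{H}$-bimodule via $a\diamond(w_1\otimes\cdots\otimes w_{n+2})\diamond b=w_1b\otimes w_2\otimes\cdots\otimes w_{n+1}\otimes aw_{n+2}$. Let $\mathcal{C}_n\colon\mathfrak{H}\to\mathfrak{H}^{\otimes(n+2)}$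 be the $\mathbb{Q}$-linear map with $\mathcal{C}_n(1)=0$, $\mathcal{C}_n(x)=x\otimes z^{\otimes n}\otimes y$, $\mathcal{C}_n(y)=-x\otimes z^{\otimes n}\otimes y$, $\mathcal{C}_n(ww')=\mathcal{C}_n(w)\diamond w'+w\diamond\mathcal{C}_n(w')$; $M_n(w_1\otimes\cdots\otimes w_{n+2})=w_1\cdots w_{n+2}$; $\rho_n=M_n\circ\mathcal{C}_n$. -}

module Defs where

open import Data.Nat as ℕ using (ℕ; zero; suc; _≤_; _<_; _∸_)
open import Data.Rational as ℚ using (ℚ; 0ℚ; 1ℚ)
open import Data.List using (List; []; _∷_; _++_; map; concat; concatMap; replicate; length; drop; take; upTo)
open import Data.Nat.ListAction using (sum)
open import Data.List.Relation.Unary.All using (All)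
open import Data.Vec as Vec using (Vec)
open import Data.Product using (Σ; ∃; _×_; _,_)
open import Relation.Binary.PropositionalEquality using (_≡_; _≢_)
open import Relation.Nullary using (¬_; yes; no; Dec)
open import Relation.Nullary.Decidable using (map′)
open import Data.List.Properties using (≡-dec)

data Letter : Set where
  x y : Letter

_≟L_ : (a b : Letter) → Dec (a ≡ b)
x ≟L x = yes _≡_.refl
x ≟L y = no (λ ())
y ≟L x = no (λ ())
y ≟L y = yes _≡_.refl

Word : Set
Word = List Letter

_≟W_ : (u v : Word) → Dec (u ≡ v)
_≟W_ = ≡-dec _≟L_

-- an element of 𝔥 is represented by a finite formal sum  Σ q·w
Poly : Set
Poly = List (ℚ × Word)

coeff : Poly → Word → ℚ
coeff [] w = 0ℚ
coeff ((q , u) ∷ p) w with u ≟W w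
... | yes _ = q ℚ.+ coeff p w
... | no _  = coeff p w

_≈_ : Poly → Poly → Set
p ≈ q = ∀ w → coeff p w ≡ coeff q w

zeroP : Poly
zeroP = []

scale : ℚ → Poly → Poly
scale c = map (λ { (q , w) → (c ℚ.* q , w) })

zw : ℕ → Word
zw k = replicate (k ∸ 1) x ++ (y ∷ [])

zws : List ℕ → Word
zws ks = concat (map zw ks)

-- (k_1,…,k_l) indexes a basis monomial of Ȟ¹_k
IsCheckIndex : ℕ → List ℕ → Set
IsCheckIndex k ks = (ks ≢ []) × All (λ kᵢ → 1 ≤ kᵢ) ks × (sum ks ≡ k) × ¬ All (λ kᵢ → kᵢ ≡ 1) ks

Comb : Set
Comb = List (ℚ × List ℕ)

combPoly : Comb → Poly
combPoly = map (λ { (q , ks) → (q , zws ks) })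

_∈Ȟ_ : Poly → ℕ → Set
p ∈Ȟ k = Σ Comb λ L → All (λ { (q , ks) → IsCheckIndex k ks }) L × (p ≈ combPoly L)

rotations : List ℕ → List (List ℕ)
rotations ks = map (λ j → drop j ks ++ take j ks) (upTo (length ks))

ρRot : List ℕ → Poly
ρRot [] = []
ρRot (h ∷ rest) =
  map (λ i → (1ℚ , zw (h ∸ i ℕ.+ 1) ++ zws rest ++ zw i)) (map suc (upTo (h ∸ 1)))
  ++ ((ℚ.- 1ℚ , zw (suc h) ++ zws rest) ∷ [])

ρMon : List ℕ → Poly
ρMon ks = concatMap ρRot (rotations ks)

ρComb : Comb → Poly
ρComb = concatMap (λ { (q , ks) → scale q (ρMon ks) })

_∈ρȞ_ : Poly → ℕ → Set
P ∈ρȞ k = Σ Comb λ L → All (λ { (q , ks) → IsCheckIndex k ks }) L × (P ≈ ρComb L)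

-- 𝔥^{⊗(n+2)}: formal sums of simple tensors w₁ ⊗ (w₂ ⊗ ⋯ ⊗ w_{n+1}) ⊗ w_{n+2}

record SimpleTensor (n : ℕ) : Set where
  constructor _⊗⟨_⟩⊗_
  field
    first : Word
    mid   : Vec Word n
    last  : Word

Tensor : ℕ → Set
Tensor n = List (ℚ × SimpleTensor n)

-- a ◇ (w₁ ⊗ ⋯ ⊗ w_{n+2}) ◇ b = w₁ b ⊗ w₂ ⊗ ⋯ ⊗ w_{n+1} ⊗ a w_{n+2}   (a, b words; extended linearly)
actL : ∀ {n} → Word → Tensor n → Tensor n
actL a = map (λ { (q , (f ⊗⟨ m ⟩⊗ l)) → (q , (f ⊗⟨ m ⟩⊗ (a ++ l))) })

actR : ∀ {n} → Tensor n → Word → Tensor n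
actR t b = map (λ { (q , (f ⊗⟨ m ⟩⊗ l)) → (q , ((f ++ b) ⊗⟨ m ⟩⊗ l)) }) t

-- z^{⊗n} with z = x + y, expanded: all choices of one letter per factor
zTensorChoices : (n : ℕ) → List (Vec Word n)
zTensorChoices zero = Vec.[] ∷ []
zTensorChoices (suc n) =
  concatMap (λ v → ((x ∷ []) Vec.∷ v) ∷ ((y ∷ []) Vec.∷ v) ∷ []) (zTensorChoices n)

genTensor : (n : ℕ) → ℚ → Tensor n
genTensor n c = map (λ v → (c , ((x ∷ []) ⊗⟨ v ⟩⊗ (y ∷ [])))) (zTensorChoices n)

𝒞gen : (n : ℕ) → Letter → Tensor n
𝒞gen n x = genTensor n 1ℚ
𝒞gen n y = genTensor n (ℚ.- 1ℚ)

𝒞W : (n : ℕ) → Word → Tensor n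
𝒞W n [] = []
𝒞W n (a ∷ w) = actR (𝒞gen n a) w ++ actL (a ∷ []) (𝒞W n w)

𝒞 : (n : ℕ) → Poly → Tensor n
𝒞 n = concatMap (λ { (q , w) → map (λ { (c , t) → (q ℚ.* c , t) }) (𝒞W n w) })

M : (n : ℕ) → Tensor n → Poly
M n = map (λ { (q , (f ⊗⟨ m ⟩⊗ l)) → (q , f ++ concat (Vec.toList m) ++ l) })

ρ_ : (n : ℕ) → Poly → Poly
ρ_ n p = M n (𝒞 n p)

_∈ρ[_]Ȟ_ : Poly → ℕ → ℕ → Set
P ∈ρ[ n ]Ȟ k = Σ Poly λ p → (p ∈Ȟ k) × (P ≈ ρ_ n p)

-- Pair polynomials with weights h : Word → ℚ by eval h (Σ q·w) = Σ q·h(w).  Two polynomials have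
-- the same coefficients iff all their pairings agree, so every identity is checked on pairings.
-- Unfolding the derivation 𝒞_n gives ρ_n(a₁⋯a_m) = Σᵢ ε(aᵢ) x a_{i+1}⋯a_m z^n a₁⋯a_{i-1} y with
-- ε(x) = 1, ε(y) = −1.  In ρ_n(xw) + ρ_n(yw) the two leading terms ±x w z^n y cancel and what is left
-- is ρ_{n+1}(w); together with z Ȟ¹_j ⊆ Ȟ¹_{j+1} this gives the inclusions, and Ȟ¹_1 has no basis
-- monomials at all.  For n = 0, the formula evaluated on z_{k₁}⋯z_{k_l} produces, block by block, the
-- terms of ρ, except that the terms −z_{k_j+1}⋯ come out cyclically shifted by one place, which does
-- not change their sum.

module Submission where

open import Defs
open import Data.Nat using (ℕ; _≤_; _<_; _∸_; _+_)
open import Data.Product using (_×_)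
open import Function.Bundles using (_⇔_)

open import Algebra.Bundles using (CommutativeMonoid)
open import Data.Empty using (⊥-elim)
open import Data.List
  using (List; []; _∷_; _++_; map; concat; concatMap; replicate; length; drop; take; upTo; applyUpTo)
import Data.List.Properties as List
open import Data.List.Relation.Unary.All using (All; []; _∷_)
open import Data.Nat using (zero; suc; z≤n; s≤s)
import Data.Nat.Properties as ℕ
open import Data.Product using (_,_)
open import Data.Rational using (ℚ; 0ℚ; 1ℚ; -_) renaming (_+_ to _⊹_; _*_ to _·_)
import Data.Rational.Properties as ℚ
import Data.Vec as Vec
open import Function using (_∘_)
open import Function.Bundles using (mk⇔)
open import Relation.Nullary using (¬_; yes; no)
open import Relation.Binary.PropositionalEquality
  using (_≡_; refl; sym; trans; cong; cong₂; subst; module ≡-Reasoning)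

open import Algebra.Properties.CommutativeSemigroup
  (CommutativeMonoid.commutativeSemigroup ℚ.+-0-commutativeMonoid)
  using (interchange; x∙yz≈y∙xz; xy∙z≈zx∙y)
open import Algebra.Properties.Group ℚ.+-0-group using (∙-cancelʳ)

open ≡-Reasoning

sumBy : {A : Set} → (A → ℚ) → List A → ℚ
sumBy f []      = 0ℚ
sumBy f (a ∷ l) = f a ⊹ sumBy f l

sumBy-++ : {A : Set} (f : A → ℚ) (l l′ : List A) → sumBy f (l ++ l′) ≡ sumBy f l ⊹ sumBy f l′
sumBy-++ f []      l′ = sym (ℚ.+-identityˡ _)
sumBy-++ f (a ∷ l) l′ = trans (cong (f a ⊹_) (sumBy-++ f l l′)) (sym (ℚ.+-assoc (f a) _ _))

sumBy-map : {A B : Set} (f : B → ℚ) (g : A → B) (l : List A) → sumBy f (map g l) ≡ sumBy (f ∘ g) l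
sumBy-map f g []      = refl
sumBy-map f g (a ∷ l) = cong (f (g a) ⊹_) (sumBy-map f g l)

sumBy-concatMap : {A B : Set} (f : B → ℚ) (g : A → List B) (l : List A) →
                  sumBy f (concatMap g l) ≡ sumBy (sumBy f ∘ g) l
sumBy-concatMap f g []      = refl
sumBy-concatMap f g (a ∷ l) =
  trans (sumBy-++ f (g a) (concatMap g l)) (cong (sumBy f (g a) ⊹_) (sumBy-concatMap f g l))

sumBy-cong : {A : Set} {f f′ : A → ℚ} → (∀ a → f a ≡ f′ a) → (l : List A) → sumBy f l ≡ sumBy f′ l
sumBy-cong f≡f′ []      = refl
sumBy-cong f≡f′ (a ∷ l) = cong₂ _⊹_ (f≡f′ a) (sumBy-cong f≡f′ l)

sumBy-*ˡ : {A : Set} (c : ℚ) (f : A → ℚ) (l : List A) → sumBy (λ a → c · f a) l ≡ c · sumBy f l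
sumBy-*ˡ c f []      = sym (ℚ.*-zeroʳ c)
sumBy-*ˡ c f (a ∷ l) = trans (cong (c · f a ⊹_) (sumBy-*ˡ c f l)) (sym (ℚ.*-distribˡ-+ c _ _))

sumBelow : ℕ → (ℕ → ℚ) → ℚ
sumBelow zero    f = 0ℚ
sumBelow (suc m) f = f 0 ⊹ sumBelow m (f ∘ suc)

sumBelow-cong : ∀ m {f g : ℕ → ℚ} → (∀ i → i < m → f i ≡ g i) → sumBelow m f ≡ sumBelow m g
sumBelow-cong zero    f≡g = refl
sumBelow-cong (suc m) f≡g = cong₂ _⊹_ (f≡g 0 (s≤s z≤n)) (sumBelow-cong m (λ i i<m → f≡g (suc i) (s≤s i<m)))

sumBy-applyUpTo : (f : ℕ → ℚ) (g : ℕ → ℕ) (m : ℕ) → sumBy f (applyUpTo g m) ≡ sumBelow m (f ∘ g)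
sumBy-applyUpTo f g zero    = refl
sumBy-applyUpTo f g (suc m) = cong (f (g 0) ⊹_) (sumBy-applyUpTo f (g ∘ suc) m)

eval : (Word → ℚ) → Poly → ℚ
eval h = sumBy (λ (q , w) → q · h w)

eval-cong : {h h′ : Word → ℚ} → (∀ w → h w ≡ h′ w) → (p : Poly) → eval h p ≡ eval h′ p
eval-cong h≡h′ = sumBy-cong (λ (q , w) → cong (q ·_) (h≡h′ w))

eval-scale : ∀ h c p → eval h (scale c p) ≡ c · eval h p
eval-scale h c p = begin
  eval h (scale c p)                 ≡⟨ sumBy-map _ _ p ⟩
  sumBy (λ (q , w) → c · q · h w) p  ≡⟨ sumBy-cong (λ (q , w) → ℚ.*-assoc c q (h w)) p ⟩
  sumBy (λ (q , w) → c · (q · h w)) p ≡⟨ sumBy-*ˡ c _ p ⟩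
  c · eval h p                       ∎

indicator : Word → Word → ℚ
indicator w u with u ≟W w
... | yes _ = 1ℚ
... | no _  = 0ℚ

coeff≡eval-indicator : ∀ w p → coeff p w ≡ eval (indicator w) p
coeff≡eval-indicator w []            = refl
coeff≡eval-indicator w ((q , u) ∷ p) with u ≟W w
... | yes _ = cong₂ _⊹_ (sym (ℚ.*-identityʳ q)) (coeff≡eval-indicator w p)
... | no _  = trans (coeff≡eval-indicator w p)
                    (sym (trans (cong (_⊹ _) (ℚ.*-zeroʳ q)) (ℚ.+-identityˡ _)))

eval≡⇒≈ : ∀ {p p′} → (∀ h → eval h p ≡ eval h p′) → p ≈ p′
eval≡⇒≈ {p} {p′} eq w =
  trans (coeff≡eval-indicator w p) (trans (eq (indicator w)) (sym (coeff≡eval-indicator w p′)))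

deleteWord : Word → Poly → Poly
deleteWord u []            = []
deleteWord u ((q , v) ∷ p) with v ≟W u
... | yes _ = deleteWord u p
... | no _  = (q , v) ∷ deleteWord u p

eval-deleteWord : ∀ h u p → eval h p ≡ coeff p u · h u ⊹ eval h (deleteWord u p)
eval-deleteWord h u []            = sym (trans (cong (_⊹ 0ℚ) (ℚ.*-zeroˡ (h u))) (ℚ.+-identityˡ 0ℚ))
eval-deleteWord h u ((q , v) ∷ p) with v ≟W u
... | yes refl = begin
  q · h v ⊹ eval h p                          ≡⟨ cong (q · h v ⊹_) (eval-deleteWord h v p) ⟩
  q · h v ⊹ (coeff p v · h v ⊹ rest)          ≡⟨ ℚ.+-assoc (q · h v) (coeff p v · h v) rest ⟨
  q · h v ⊹ coeff p v · h v ⊹ rest            ≡⟨ cong (_⊹ rest) (ℚ.*-distribʳ-+ (h v) q (coeff p v)) ⟨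
  (q ⊹ coeff p v) · h v ⊹ rest                ∎
  where rest : ℚ
        rest = eval h (deleteWord v p)
... | no _ = begin
  q · h v ⊹ eval h p                          ≡⟨ cong (q · h v ⊹_) (eval-deleteWord h u p) ⟩
  q · h v ⊹ (coeff p u · h u ⊹ rest)          ≡⟨ x∙yz≈y∙xz (q · h v) (coeff p u · h u) rest ⟩
  coeff p u · h u ⊹ (q · h v ⊹ rest)          ∎
  where rest : ℚ
        rest = eval h (deleteWord u p)

coeff-deleteWord-self : ∀ u p → coeff (deleteWord u p) u ≡ 0ℚ
coeff-deleteWord-self u []            = refl
coeff-deleteWord-self u ((q , v) ∷ p) with v ≟W u
... | yes _ = coeff-deleteWord-self u p
... | no v≢u with v ≟W u
...   | yes v≡u = ⊥-elim (v≢u v≡u)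
...   | no _    = coeff-deleteWord-self u p

coeff-deleteWord-other : ∀ u w p → ¬ w ≡ u → coeff (deleteWord u p) w ≡ coeff p w
coeff-deleteWord-other u w []            w≢u = refl
coeff-deleteWord-other u w ((q , v) ∷ p) w≢u with v ≟W u
... | yes refl with v ≟W w
...   | yes refl = ⊥-elim (w≢u refl)
...   | no _     = coeff-deleteWord-other u w p w≢u
coeff-deleteWord-other u w ((q , v) ∷ p) w≢u | no _ with v ≟W w
...   | yes _ = cong (q ⊹_) (coeff-deleteWord-other u w p w≢u)
...   | no _  = coeff-deleteWord-other u w p w≢u

deleteWord-≈ : ∀ u p p′ → p ≈ p′ → deleteWord u p ≈ deleteWord u p′
deleteWord-≈ u p p′ p≈p′ w with w ≟W u
... | yes refl = trans (coeff-deleteWord-self w p) (sym (coeff-deleteWord-self w p′))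
... | no w≢u   = trans (coeff-deleteWord-other u w p w≢u)
                       (trans (p≈p′ w) (sym (coeff-deleteWord-other u w p′ w≢u)))

length-deleteWord : ∀ u p → length (deleteWord u p) ≤ length p
length-deleteWord u []            = z≤n
length-deleteWord u ((q , v) ∷ p) with v ≟W u
... | yes _ = ℕ.m≤n⇒m≤1+n (length-deleteWord u p)
... | no _  = s≤s (length-deleteWord u p)

length-deleteWord-head : ∀ u q p → length (deleteWord u ((q , u) ∷ p)) ≤ length p
length-deleteWord-head u q p with u ≟W u
... | yes _  = length-deleteWord u p
... | no u≢u = ⊥-elim (u≢u refl)

eval-cong-deleteWord : ∀ h u p p′ → p ≈ p′ →
  eval h (deleteWord u p) ≡ eval h (deleteWord u p′) → eval h p ≡ eval h p′
eval-cong-deleteWord h u p p′ p≈p′ eq = begin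
  eval h p                                   ≡⟨ eval-deleteWord h u p ⟩
  coeff p u · h u ⊹ eval h (deleteWord u p)   ≡⟨ cong₂ (λ c e → c · h u ⊹ e) (p≈p′ u) eq ⟩
  coeff p′ u · h u ⊹ eval h (deleteWord u p′) ≡⟨ eval-deleteWord h u p′ ⟨
  eval h p′                                  ∎

-- Deleting the first word occurring in p or p′ decreases the total length.
≈⇒eval≡-bounded : ∀ n h p p′ → length p + length p′ ≤ n → p ≈ p′ → eval h p ≡ eval h p′
≈⇒eval≡-bounded n       h []               []               _   _    = refl
≈⇒eval≡-bounded (suc n) h p@((q , u) ∷ r) p′               len p≈p′ =
  eval-cong-deleteWord h u p p′ p≈p′
    (≈⇒eval≡-bounded n h (deleteWord u p) (deleteWord u p′) shorter (deleteWord-≈ u p p′ p≈p′))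
  where
  shorter : length (deleteWord u p) + length (deleteWord u p′) ≤ n
  shorter = ℕ.≤-trans (ℕ.+-mono-≤ (length-deleteWord-head u q r) (length-deleteWord u p′)) (ℕ.≤-pred len)
≈⇒eval≡-bounded (suc n) h []               p′@((q , u) ∷ r) len p≈p′ =
  eval-cong-deleteWord h u [] p′ p≈p′
    (≈⇒eval≡-bounded n h [] (deleteWord u p′) shorter (deleteWord-≈ u [] p′ p≈p′))
  where
  shorter : length (deleteWord u p′) ≤ n
  shorter = ℕ.≤-trans (length-deleteWord-head u q r) (ℕ.≤-pred len)

≈⇒eval≡ : ∀ {p p′} → p ≈ p′ → ∀ h → eval h p ≡ eval h p′
≈⇒eval≡ {p} {p′} p≈p′ h = ≈⇒eval≡-bounded _ h p p′ ℕ.≤-refl p≈p′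

-- A closed formula for ρ_n

ε : Letter → ℚ
ε x = 1ℚ
ε y = - 1ℚ

𝒞gen≡genTensor-ε : ∀ n a → 𝒞gen n a ≡ genTensor n (ε a)
𝒞gen≡genTensor-ε n x = refl
𝒞gen≡genTensor-ε n y = refl

sumWords : ℕ → (Word → ℚ) → ℚ
sumWords zero    g = g []
sumWords (suc n) g = sumWords n (λ s → g (x ∷ s) ⊹ g (y ∷ s))

sumWords-cong : ∀ n {g g′ : Word → ℚ} → (∀ s → g s ≡ g′ s) → sumWords n g ≡ sumWords n g′
sumWords-cong zero    g≡g′ = g≡g′ []
sumWords-cong (suc n) g≡g′ = sumWords-cong n (λ s → cong₂ _⊹_ (g≡g′ (x ∷ s)) (g≡g′ (y ∷ s)))

sumWords-+ : ∀ n (g g′ : Word → ℚ) → sumWords n (λ s → g s ⊹ g′ s) ≡ sumWords n g ⊹ sumWords n g′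
sumWords-+ zero    g g′ = refl
sumWords-+ (suc n) g g′ =
  trans (sumWords-cong n (λ s → interchange (g (x ∷ s)) (g′ (x ∷ s)) (g (y ∷ s)) (g′ (y ∷ s))))
        (sumWords-+ n _ _)

sumWords-suc-snoc : ∀ n (g : Word → ℚ) →
  sumWords (suc n) g ≡ sumWords n (λ s → g (s ++ x ∷ []) ⊹ g (s ++ y ∷ []))
sumWords-suc-snoc zero    g = refl
sumWords-suc-snoc (suc n) g =
  trans (sumWords-suc-snoc n (λ s → g (x ∷ s) ⊹ g (y ∷ s)))
        (sumWords-cong n (λ s → interchange (g (x ∷ s ++ x ∷ [])) (g (y ∷ s ++ x ∷ []))
                                            (g (x ∷ s ++ y ∷ [])) (g (y ∷ s ++ y ∷ []))))

sumBy-zTensorChoices : ∀ n (g : Word → ℚ) →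
  sumBy (λ m → g (concat (Vec.toList m))) (zTensorChoices n) ≡ sumWords n g
sumBy-zTensorChoices zero    g = ℚ.+-identityʳ (g [])
sumBy-zTensorChoices (suc n) g =
  trans (sumBy-concatMap _ _ (zTensorChoices n))
    (trans (sumBy-cong (λ m → cong (g (x ∷ _) ⊹_) (ℚ.+-identityʳ _)) (zTensorChoices n))
      (sumBy-zTensorChoices n (λ s → g (x ∷ s) ⊹ g (y ∷ s))))

-- The pairing of h with M_n(pre ◇ T).
evalM : ∀ {n} → (Word → ℚ) → Word → Tensor n → ℚ
evalM h pre = sumBy (λ (q , f ⊗⟨ m ⟩⊗ l) → q · h (f ++ concat (Vec.toList m) ++ pre ++ l))

eval-M : ∀ n h (T : Tensor n) → eval h (M n T) ≡ evalM h [] T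
eval-M n h T = sumBy-map _ _ T

evalM-actL : ∀ {n} h pre b (T : Tensor n) → evalM h pre (actL b T) ≡ evalM h (pre ++ b) T
evalM-actL h pre b T =
  trans (sumBy-map _ _ T)
        (sumBy-cong (λ (q , f ⊗⟨ m ⟩⊗ l) →
                       cong (λ r → q · h (f ++ concat (Vec.toList m) ++ r)) (sym (List.++-assoc pre b l))) T)

evalM-actR-genTensor : ∀ n h pre c v →
  evalM h pre (actR (genTensor n c) v) ≡ c · sumWords n (λ s → h (x ∷ v ++ s ++ pre ++ y ∷ []))
evalM-actR-genTensor n h pre c v =
  trans (sumBy-map _ _ (genTensor n c))
   (trans (sumBy-map _ _ (zTensorChoices n))
    (trans (sumBy-*ˡ c _ (zTensorChoices n))
      (cong (c ·_) (sumBy-zTensorChoices n (λ s → h (x ∷ v ++ s ++ pre ++ y ∷ []))))))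

-- ρ-dual n h [] w is the pairing of h with ρ_n(w); the accumulator pre holds a₁⋯a_{i-1}.
ρ-dual : ℕ → (Word → ℚ) → Word → Word → ℚ
ρ-dual n h pre []      = 0ℚ
ρ-dual n h pre (a ∷ v) =
  ε a · sumWords n (λ s → h (x ∷ v ++ s ++ pre ++ y ∷ [])) ⊹ ρ-dual n h (pre ++ a ∷ []) v

evalM-𝒞W : ∀ n h pre w → evalM h pre (𝒞W n w) ≡ ρ-dual n h pre w
evalM-𝒞W n h pre []      = refl
evalM-𝒞W n h pre (a ∷ v) =
  trans (sumBy-++ _ (actR (𝒞gen n a) v) (actL (a ∷ []) (𝒞W n v)))
   (cong₂ _⊹_
     (trans (cong (λ G → evalM h pre (actR G v)) (𝒞gen≡genTensor-ε n a)) (evalM-actR-genTensor n h pre (ε a) v))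
     (trans (evalM-actL h pre (a ∷ []) (𝒞W n v)) (evalM-𝒞W n h (pre ++ a ∷ []) v)))

eval-ρ : ∀ n h p → eval h (ρ_ n p) ≡ eval (ρ-dual n h []) p
eval-ρ n h p =
  trans (eval-M n h (𝒞 n p))
   (trans (sumBy-concatMap _ _ p) (sumBy-cong monomial p))
  where
  value : SimpleTensor n → ℚ
  value (f ⊗⟨ m ⟩⊗ l) = h (f ++ concat (Vec.toList m) ++ l)
  monomial : ((q , w) : ℚ × Word) → evalM h [] (map (λ (c , t) → (q · c , t)) (𝒞W n w)) ≡ q · ρ-dual n h [] w
  monomial (q , w) = begin
    evalM h [] (map (λ (c , t) → (q · c , t)) (𝒞W n w)) ≡⟨ sumBy-map _ _ (𝒞W n w) ⟩
    sumBy (λ (c , t) → q · c · value t) (𝒞W n w)         ≡⟨ sumBy-cong (λ (c , t) → ℚ.*-assoc q c (value t)) (𝒞W n w) ⟩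
    sumBy (λ (c , t) → q · (c · value t)) (𝒞W n w)       ≡⟨ sumBy-*ˡ q _ (𝒞W n w) ⟩
    q · evalM h [] (𝒞W n w)                              ≡⟨ cong (q ·_) (evalM-𝒞W n h [] w) ⟩
    q · ρ-dual n h [] w                                  ∎

ρ-resp-≈ : ∀ n {p p′} → p ≈ p′ → ρ_ n p ≈ ρ_ n p′
ρ-resp-≈ n {p} {p′} p≈p′ = eval≡⇒≈ {ρ_ n p} {ρ_ n p′} λ h →
  trans (eval-ρ n h p) (trans (≈⇒eval≡ {p} {p′} p≈p′ _) (sym (eval-ρ n h p′)))

-- ρ_{n+1}(w) = ρ_n(zw), and z Ȟ¹_j ⊆ Ȟ¹_{j+1}

ρ-dual-z·-acc : ∀ n h pre u →
  ρ-dual n h (x ∷ pre) u ⊹ ρ-dual n h (y ∷ pre) u ≡ ρ-dual (suc n) h pre u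
ρ-dual-z·-acc n h pre []      = ℚ.+-identityʳ 0ℚ
ρ-dual-z·-acc n h pre (b ∷ v) = begin
  (ε b · Sx ⊹ Rx) ⊹ (ε b · Sy ⊹ Ry)   ≡⟨ interchange (ε b · Sx) Rx (ε b · Sy) Ry ⟩
  (ε b · Sx ⊹ ε b · Sy) ⊹ (Rx ⊹ Ry)   ≡⟨ cong₂ _⊹_ (sym (ℚ.*-distribˡ-+ (ε b) Sx Sy))
                                                   (ρ-dual-z·-acc n h (pre ++ b ∷ []) v) ⟩
  ε b · (Sx ⊹ Sy) ⊹ ρ-dual (suc n) h (pre ++ b ∷ []) v
                                      ≡⟨ cong (λ S → ε b · S ⊹ ρ-dual (suc n) h (pre ++ b ∷ []) v) merge ⟩
  ρ-dual (suc n) h pre (b ∷ v)        ∎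
  where
  term : Word → ℚ
  term t = h (x ∷ v ++ t ++ pre ++ y ∷ [])
  Sx Sy Rx Ry : ℚ
  Sx = sumWords n (λ s → h (x ∷ v ++ s ++ x ∷ pre ++ y ∷ []))
  Sy = sumWords n (λ s → h (x ∷ v ++ s ++ y ∷ pre ++ y ∷ []))
  Rx = ρ-dual n h (x ∷ pre ++ b ∷ []) v
  Ry = ρ-dual n h (y ∷ pre ++ b ∷ []) v
  merge : Sx ⊹ Sy ≡ sumWords (suc n) term
  merge = begin
    Sx ⊹ Sy                                                      ≡⟨ sumWords-+ n _ _ ⟨
    sumWords n (λ s → h (x ∷ v ++ s ++ x ∷ pre ++ y ∷ []) ⊹ h (x ∷ v ++ s ++ y ∷ pre ++ y ∷ []))
      ≡⟨ sumWords-cong n (λ s → cong₂ _⊹_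
           (cong (λ t → h (x ∷ v ++ t)) (sym (List.++-assoc s (x ∷ []) (pre ++ y ∷ []))))
           (cong (λ t → h (x ∷ v ++ t)) (sym (List.++-assoc s (y ∷ []) (pre ++ y ∷ []))))) ⟩
    sumWords n (λ s → term (s ++ x ∷ []) ⊹ term (s ++ y ∷ []))    ≡⟨ sumWords-suc-snoc n term ⟨
    sumWords (suc n) term                                        ∎

ρ-dual-z· : ∀ n h u → ρ-dual n h [] (x ∷ u) ⊹ ρ-dual n h [] (y ∷ u) ≡ ρ-dual (suc n) h [] u
ρ-dual-z· n h u = begin
  (1ℚ · S ⊹ Rx) ⊹ ((- 1ℚ) · S ⊹ Ry)   ≡⟨ interchange (1ℚ · S) Rx ((- 1ℚ) · S) Ry ⟩
  (1ℚ · S ⊹ (- 1ℚ) · S) ⊹ (Rx ⊹ Ry)   ≡⟨ cong (_⊹ (Rx ⊹ Ry)) (ℚ.*-distribʳ-+ S 1ℚ (- 1ℚ)) ⟨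
  (1ℚ ⊹ - 1ℚ) · S ⊹ (Rx ⊹ Ry)         ≡⟨ cong (λ c → c · S ⊹ (Rx ⊹ Ry)) (ℚ.+-inverseʳ 1ℚ) ⟩
  0ℚ · S ⊹ (Rx ⊹ Ry)                  ≡⟨ cong (_⊹ (Rx ⊹ Ry)) (ℚ.*-zeroˡ S) ⟩
  0ℚ ⊹ (Rx ⊹ Ry)                      ≡⟨ ℚ.+-identityˡ (Rx ⊹ Ry) ⟩
  Rx ⊹ Ry                             ≡⟨ ρ-dual-z·-acc n h [] u ⟩
  ρ-dual (suc n) h [] u               ∎
  where
  S Rx Ry : ℚ
  S  = sumWords n (λ s → h (x ∷ u ++ s ++ y ∷ []))
  Rx = ρ-dual n h (x ∷ []) u
  Ry = ρ-dual n h (y ∷ []) u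

z· : Poly → Poly
z· = concatMap (λ (q , w) → (q , x ∷ w) ∷ (q , y ∷ w) ∷ [])

eval-z· : ∀ h p → eval h (z· p) ≡ eval (λ u → h (x ∷ u) ⊹ h (y ∷ u)) p
eval-z· h p =
  trans (sumBy-concatMap _ _ p)
        (sumBy-cong (λ (q , w) → trans (cong (q · h (x ∷ w) ⊹_) (ℚ.+-identityʳ _))
                                       (sym (ℚ.*-distribˡ-+ q _ _))) p)

ρ-suc≈ρ-z· : ∀ n p → ρ_ (suc n) p ≈ ρ_ n (z· p)
ρ-suc≈ρ-z· n p = eval≡⇒≈ {ρ_ (suc n) p} {ρ_ n (z· p)} λ h → begin
  eval h (ρ_ (suc n) p)                                          ≡⟨ eval-ρ (suc n) h p ⟩
  eval (ρ-dual (suc n) h []) p                                   ≡⟨ eval-cong (sym ∘ ρ-dual-z· n h) p ⟩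
  eval (λ u → ρ-dual n h [] (x ∷ u) ⊹ ρ-dual n h [] (y ∷ u)) p   ≡⟨ eval-z· (ρ-dual n h []) p ⟨
  eval (ρ-dual n h []) (z· p)                                    ≡⟨ eval-ρ n h (z· p) ⟨
  eval h (ρ_ n (z· p))                                           ∎

z·-resp-≈ : ∀ {p p′} → p ≈ p′ → z· p ≈ z· p′
z·-resp-≈ {p} {p′} p≈p′ = eval≡⇒≈ {z· p} {z· p′} λ h →
  trans (eval-z· h p) (trans (≈⇒eval≡ {p} {p′} p≈p′ _) (sym (eval-z· h p′)))

CheckIndexed : ℕ → Comb → Set
CheckIndexed k = All (λ (q , ks) → IsCheckIndex k ks)

incrHead : List ℕ → List ℕ
incrHead []       = []
incrHead (k ∷ ks) = suc k ∷ ks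

-- x z_{k₁} z_{k₂}⋯ = z_{k₁+1} z_{k₂}⋯  and  y z_{k₁} z_{k₂}⋯ = z₁ z_{k₁} z_{k₂}⋯
z·Comb : Comb → Comb
z·Comb = concatMap (λ (q , ks) → (q , incrHead ks) ∷ (q , 1 ∷ ks) ∷ [])

z·-combPoly : ∀ k L → CheckIndexed k L → z· (combPoly L) ≡ combPoly (z·Comb L)
z·-combPoly k []                     []                         = refl
z·-combPoly k ((q , [])          ∷ L) ((ks≢[] , _) ∷ _)          = ⊥-elim (ks≢[] refl)
z·-combPoly k ((q , (zero ∷ ks)) ∷ L) ((_ , (() ∷ _) , _) ∷ _)
z·-combPoly k ((q , (suc _ ∷ _)) ∷ L) (_ ∷ L-ok)                 =
  cong (λ r → (q , _) ∷ (q , _) ∷ r) (z·-combPoly k L L-ok)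

incrHead-IsCheckIndex : ∀ k ks → IsCheckIndex k ks → IsCheckIndex (suc k) (incrHead ks)
incrHead-IsCheckIndex k []       (ks≢[] , _)                 = ⊥-elim (ks≢[] refl)
incrHead-IsCheckIndex k (zero ∷ ks) (_ , (() ∷ _) , _)
incrHead-IsCheckIndex k (suc _ ∷ ks) (_ , (_ ∷ ks≥1) , Σks≡k , _) =
  (λ ()) , s≤s z≤n ∷ ks≥1 , cong suc Σks≡k , λ { (() ∷ _) }

cons1-IsCheckIndex : ∀ k ks → IsCheckIndex k ks → IsCheckIndex (suc k) (1 ∷ ks)
cons1-IsCheckIndex k ks (_ , ks≥1 , Σks≡k , ks≢1s) =
  (λ ()) , s≤s z≤n ∷ ks≥1 , cong suc Σks≡k , λ { (_ ∷ ks≡1s) → ks≢1s ks≡1s }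

z·Comb-CheckIndexed : ∀ k L → CheckIndexed k L → CheckIndexed (suc k) (z·Comb L)
z·Comb-CheckIndexed k []             []             = []
z·Comb-CheckIndexed k ((q , ks) ∷ L) (ks-ok ∷ L-ok) =
  incrHead-IsCheckIndex k ks ks-ok ∷ cons1-IsCheckIndex k ks ks-ok ∷ z·Comb-CheckIndexed k L L-ok

∈ρ-suc⇒∈ρ : ∀ {n k} P → P ∈ρ[ suc n ]Ȟ k → P ∈ρ[ n ]Ȟ suc k
∈ρ-suc⇒∈ρ {n} {k} P (p , (L , L-ok , p≈L) , P≈ρp) =
  z· p ,
  (z·Comb L , z·Comb-CheckIndexed k L L-ok ,
   λ w → trans (z·-resp-≈ {p} {combPoly L} p≈L w) (cong (λ r → coeff r w) (z·-combPoly k L L-ok))) ,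
  λ w → trans (P≈ρp w) (ρ-suc≈ρ-z· n p w)

-- ρ₀ = ρ on Ȟ¹

zws-++ : ∀ A B → zws (A ++ B) ≡ zws A ++ zws B
zws-++ A B = trans (cong concat (List.map-++ zw A B)) (sym (List.concat-++ (map zw A) (map zw B)))

zws-snoc : ∀ A c → zws (A ++ c ∷ []) ≡ zws A ++ zw c
zws-snoc A c = trans (zws-++ A (c ∷ [])) (cong (zws A ++_) (List.++-identityʳ (zw c)))

∸≡suc-∸-suc : ∀ j m → suc j ≤ m → m ∸ j ≡ suc (m ∸ suc j)
∸≡suc-∸-suc zero    (suc m) _         = refl
∸≡suc-∸-suc (suc j) (suc m) (s≤s j<m) = ∸≡suc-∸-suc j m j<m

zw-split : ∀ i m R → i < m → zw (suc m ∸ suc i + 1) ++ R ≡ x ∷ replicate (m ∸ suc i) x ++ y ∷ R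
zw-split i m R i<m = begin
  (replicate (m ∸ i + 1 ∸ 1) x ++ y ∷ []) ++ R
    ≡⟨ cong (λ t → (replicate t x ++ y ∷ []) ++ R) (trans (ℕ.m+n∸n≡m (m ∸ i) 1) (∸≡suc-∸-suc i m i<m)) ⟩
  x ∷ (replicate (m ∸ suc i) x ++ y ∷ []) ++ R
    ≡⟨ cong (x ∷_) (List.++-assoc (replicate (m ∸ suc i) x) (y ∷ []) R) ⟩
  x ∷ replicate (m ∸ suc i) x ++ y ∷ R
    ∎

-- sumSplits F A (C₁ ++ c ∷ C₂) sums F (A ++ C₁) c C₂ over all such splittings.
sumSplits : (List ℕ → ℕ → List ℕ → ℚ) → List ℕ → List ℕ → ℚ
sumSplits F A []      = 0ℚ
sumSplits F A (c ∷ C) = F A c C ⊹ sumSplits F (A ++ c ∷ []) C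

sumSplits-cong : ∀ {F F′ : List ℕ → ℕ → List ℕ → ℚ} A B → All (1 ≤_) B →
  (∀ A c C → 1 ≤ c → F A c C ≡ F′ A c C) → sumSplits F A B ≡ sumSplits F′ A B
sumSplits-cong A []      []            F≡F′ = refl
sumSplits-cong A (c ∷ C) (c≥1 ∷ C≥1) F≡F′ =
  cong₂ _⊹_ (F≡F′ A c C c≥1) (sumSplits-cong (A ++ c ∷ []) C C≥1 F≡F′)

sumSplits-+ : ∀ (F F′ : List ℕ → ℕ → List ℕ → ℚ) A B →
  sumSplits (λ A c C → F A c C ⊹ F′ A c C) A B ≡ sumSplits F A B ⊹ sumSplits F′ A B
sumSplits-+ F F′ A []      = sym (ℚ.+-identityʳ 0ℚ)
sumSplits-+ F F′ A (c ∷ C) =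
  trans (cong (F A c C ⊹ F′ A c C ⊹_) (sumSplits-+ F F′ (A ++ c ∷ []) C))
        (interchange (F A c C) (F′ A c C) (sumSplits F (A ++ c ∷ []) C) (sumSplits F′ (A ++ c ∷ []) C))

-- Telescoping: moving the split letter c from the back to the front shifts the sum by one rotation.
sumSplits-rotate-acc : ∀ (f : List ℕ → ℚ) A B →
  sumSplits (λ A c C → f (C ++ A ++ c ∷ [])) A B ⊹ f (B ++ A) ≡
  sumSplits (λ A c C → f (c ∷ C ++ A)) A B ⊹ f (A ++ B)
sumSplits-rotate-acc f A []      = cong (λ w → 0ℚ ⊹ f w) (sym (List.++-identityʳ A))
sumSplits-rotate-acc f A (c ∷ C) = begin
  (f (C ++ A ++ c ∷ []) ⊹ Back) ⊹ f (c ∷ C ++ A)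
    ≡⟨ cong (_⊹ f (c ∷ C ++ A)) (ℚ.+-comm (f (C ++ A ++ c ∷ [])) Back) ⟩
  (Back ⊹ f (C ++ A ++ c ∷ [])) ⊹ f (c ∷ C ++ A)
    ≡⟨ cong (_⊹ f (c ∷ C ++ A)) (sumSplits-rotate-acc f (A ++ c ∷ []) C) ⟩
  (Front ⊹ f ((A ++ c ∷ []) ++ C)) ⊹ f (c ∷ C ++ A)
    ≡⟨ xy∙z≈zx∙y Front _ (f (c ∷ C ++ A)) ⟩
  (f (c ∷ C ++ A) ⊹ Front) ⊹ f ((A ++ c ∷ []) ++ C)
    ≡⟨ cong (λ w → f (c ∷ C ++ A) ⊹ Front ⊹ f w) (List.++-assoc A (c ∷ []) C) ⟩
  (f (c ∷ C ++ A) ⊹ Front) ⊹ f (A ++ c ∷ C)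
    ∎
  where
  Back Front : ℚ
  Back  = sumSplits (λ A c C → f (C ++ A ++ c ∷ [])) (A ++ c ∷ []) C
  Front = sumSplits (λ A c C → f (c ∷ C ++ A)) (A ++ c ∷ []) C

sumSplits-rotate : ∀ (f : List ℕ → ℚ) B →
  sumSplits (λ A c C → f (C ++ A ++ c ∷ [])) [] B ≡ sumSplits (λ A c C → f (c ∷ C ++ A)) [] B
sumSplits-rotate f B =
  ∙-cancelʳ (f B) Back _
    (trans (cong (λ w → Back ⊹ f w) (sym (List.++-identityʳ B))) (sumSplits-rotate-acc f [] B))
  where
  Back : ℚ
  Back = sumSplits (λ A c C → f (C ++ A ++ c ∷ [])) [] B

sumSplits≡sum-rotations : ∀ (Φ : List ℕ → ℚ) A B →
  sumSplits (λ A c C → Φ (c ∷ C ++ A)) A B ≡ sumBelow (length B) (λ j → Φ (drop j B ++ A ++ take j B))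
sumSplits≡sum-rotations Φ A []      = refl
sumSplits≡sum-rotations Φ A (c ∷ C) =
  cong₂ _⊹_ (cong (λ w → Φ (c ∷ C ++ w)) (sym (List.++-identityʳ A)))
    (trans (sumSplits≡sum-rotations Φ (A ++ c ∷ []) C)
      (sumBelow-cong (length C) (λ j _ → cong (λ w → Φ (drop j C ++ w)) (List.++-assoc A (c ∷ []) (take j C)))))

module _ (h : Word → ℚ) where

  xTerms : ℕ → Word → Word → ℚ
  xTerms m pre rest = sumBelow m (λ i → h (x ∷ replicate (m ∸ suc i) x ++ y ∷ rest ++ pre ++ replicate i x ++ y ∷ []))

  yTerm : Word → ℚ
  yTerm w = - 1ℚ · h (x ∷ w)

  G : List ℕ → ℕ → List ℕ → ℚ
  G A c C = xTerms (c ∸ 1) [] (zws (C ++ A)) ⊹ yTerm (zws (C ++ A ++ c ∷ []))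

  xTerms-suc : ∀ m pre rest →
    xTerms (suc m) pre rest ≡ h (x ∷ replicate m x ++ y ∷ rest ++ pre ++ y ∷ []) ⊹ xTerms m (pre ++ x ∷ []) rest
  xTerms-suc m pre rest =
    cong (h (x ∷ replicate m x ++ y ∷ rest ++ pre ++ y ∷ []) ⊹_) (sumBelow-cong m λ i _ →
      cong (λ w → h (x ∷ replicate (m ∸ suc i) x ++ y ∷ rest ++ w))
           (sym (List.++-assoc pre (x ∷ []) (replicate i x ++ y ∷ []))))

  xTerms-++ : ∀ m pre rest → xTerms m pre rest ≡ xTerms m [] (rest ++ pre)
  xTerms-++ m pre rest = sumBelow-cong m λ i _ →
    cong (λ w → h (x ∷ replicate (m ∸ suc i) x ++ y ∷ w)) (sym (List.++-assoc rest pre (replicate i x ++ y ∷ [])))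

  ρ-dual₀-block : ∀ m pre rest → ρ-dual 0 h pre (replicate m x ++ y ∷ rest) ≡
    xTerms m pre rest ⊹ (yTerm (rest ++ pre ++ replicate m x ++ y ∷ []) ⊹ ρ-dual 0 h (pre ++ replicate m x ++ y ∷ []) rest)
  ρ-dual₀-block zero    pre rest = sym (ℚ.+-identityˡ _)
  ρ-dual₀-block (suc m) pre rest = begin
    1ℚ · h (x ∷ (replicate m x ++ y ∷ rest) ++ pre ++ y ∷ []) ⊹ ρ-dual 0 h (pre ++ x ∷ []) (replicate m x ++ y ∷ rest)
      ≡⟨ cong₂ _⊹_ head (ρ-dual₀-block m (pre ++ x ∷ []) rest) ⟩
    H ⊹ (xTerms m (pre ++ x ∷ []) rest ⊹ later ((pre ++ x ∷ []) ++ xsy))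
      ≡⟨ ℚ.+-assoc H _ _ ⟨
    H ⊹ xTerms m (pre ++ x ∷ []) rest ⊹ later ((pre ++ x ∷ []) ++ xsy)
      ≡⟨ cong₂ _⊹_ (sym (xTerms-suc m pre rest)) (cong later (List.++-assoc pre (x ∷ []) xsy)) ⟩
    xTerms (suc m) pre rest ⊹ later (pre ++ x ∷ xsy)
      ∎
    where
    xsy : Word
    xsy = replicate m x ++ y ∷ []
    H : ℚ
    H = h (x ∷ replicate m x ++ y ∷ rest ++ pre ++ y ∷ [])
    later : Word → ℚ
    later w = yTerm (rest ++ w) ⊹ ρ-dual 0 h w rest
    head : 1ℚ · h (x ∷ (replicate m x ++ y ∷ rest) ++ pre ++ y ∷ []) ≡ H
    head = trans (ℚ.*-identityˡ _) (cong (λ w → h (x ∷ w)) (List.++-assoc (replicate m x) (y ∷ rest) (pre ++ y ∷ [])))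

  ρ-dual₀-zws : ∀ A B → All (1 ≤_) B → ρ-dual 0 h (zws A) (zws B) ≡ sumSplits G A B
  ρ-dual₀-zws A []            []          = refl
  ρ-dual₀-zws A (suc m ∷ C) (_ ∷ C≥1) = begin
    ρ-dual 0 h (zws A) (zw (suc m) ++ zws C)
      ≡⟨ cong (ρ-dual 0 h (zws A)) (List.++-assoc (replicate m x) (y ∷ []) (zws C)) ⟩
    ρ-dual 0 h (zws A) (replicate m x ++ y ∷ zws C)
      ≡⟨ ρ-dual₀-block m (zws A) (zws C) ⟩
    xTerms m (zws A) (zws C) ⊹ (yTerm (zws C ++ zws A ++ zw (suc m)) ⊹ ρ-dual 0 h (zws A ++ zw (suc m)) (zws C))
      ≡⟨ ℚ.+-assoc (xTerms m (zws A) (zws C)) _ _ ⟨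
    xTerms m (zws A) (zws C) ⊹ yTerm (zws C ++ zws A ++ zw (suc m)) ⊹ ρ-dual 0 h (zws A ++ zw (suc m)) (zws C)
      ≡⟨ cong₂ _⊹_ (cong₂ _⊹_ x-part (cong yTerm y-word)) (trans later-blocks (ρ-dual₀-zws (A ++ suc m ∷ []) C C≥1)) ⟩
    G A (suc m) C ⊹ sumSplits G (A ++ suc m ∷ []) C
      ∎
    where
    x-part : xTerms m (zws A) (zws C) ≡ xTerms m [] (zws (C ++ A))
    x-part = trans (xTerms-++ m (zws A) (zws C)) (cong (xTerms m []) (sym (zws-++ C A)))
    y-word : zws C ++ zws A ++ zw (suc m) ≡ zws (C ++ A ++ suc m ∷ [])
    y-word = sym (trans (zws-++ C (A ++ suc m ∷ [])) (cong (zws C ++_) (zws-snoc A (suc m))))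
    later-blocks : ρ-dual 0 h (zws A ++ zw (suc m)) (zws C) ≡ ρ-dual 0 h (zws (A ++ suc m ∷ [])) (zws C)
    later-blocks = cong (λ w → ρ-dual 0 h w (zws C)) (sym (zws-snoc A (suc m)))

  eval-ρRot : ∀ m R → eval h (ρRot (suc m ∷ R)) ≡ xTerms m [] (zws R) ⊹ yTerm (zws (suc m ∷ R))
  eval-ρRot m R = trans (sumBy-++ _ (map z-pairs (map suc (upTo m))) _) (cong₂ _⊹_ x-part (ℚ.+-identityʳ _))
    where
    z-pairs : ℕ → ℚ × Word
    z-pairs i = 1ℚ , zw (suc m ∸ i + 1) ++ zws R ++ zw i
    x-part : eval h (map z-pairs (map suc (upTo m))) ≡ xTerms m [] (zws R)
    x-part = begin
      eval h (map z-pairs (map suc (upTo m)))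
        ≡⟨ trans (sumBy-map _ _ (map suc (upTo m))) (trans (sumBy-map _ _ (upTo m)) (sumBy-applyUpTo _ (λ i → i) m)) ⟩
      sumBelow m (λ i → 1ℚ · h (zw (suc m ∸ suc i + 1) ++ zws R ++ zw (suc i)))
        ≡⟨ sumBelow-cong m (λ i i<m → trans (ℚ.*-identityˡ _) (cong h (zw-split i m (zws R ++ zw (suc i)) i<m))) ⟩
      xTerms m [] (zws R)
        ∎

  eval-ρMon : ∀ ks → eval h (ρMon ks) ≡ sumSplits (λ A c C → eval h (ρRot (c ∷ C ++ A))) [] ks
  eval-ρMon ks =
    trans (sumBy-concatMap _ ρRot (rotations ks))
     (trans (sumBy-map _ _ (upTo (length ks)))
      (trans (sumBy-applyUpTo _ (λ i → i) (length ks))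
        (sym (sumSplits≡sum-rotations (eval h ∘ ρRot) [] ks))))

  ρ-dual₀-zws≡eval-ρMon : ∀ ks → All (1 ≤_) ks → ρ-dual 0 h [] (zws ks) ≡ eval h (ρMon ks)
  ρ-dual₀-zws≡eval-ρMon ks ks≥1 = begin
    ρ-dual 0 h [] (zws ks)                          ≡⟨ ρ-dual₀-zws [] ks ks≥1 ⟩
    sumSplits (λ A c C → X A c C ⊹ Yback A c C) [] ks ≡⟨ sumSplits-+ X Yback [] ks ⟩
    sumSplits X [] ks ⊹ sumSplits Yback [] ks        ≡⟨ cong (sumSplits X [] ks ⊹_) (sumSplits-rotate (yTerm ∘ zws) ks) ⟩
    sumSplits X [] ks ⊹ sumSplits Yfront [] ks       ≡⟨ sumSplits-+ X Yfront [] ks ⟨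
    sumSplits (λ A c C → X A c C ⊹ Yfront A c C) [] ks
      ≡⟨ sumSplits-cong [] ks ks≥1 (λ { A (suc m) C _ → sym (eval-ρRot m (C ++ A)) }) ⟩
    sumSplits (λ A c C → eval h (ρRot (c ∷ C ++ A))) [] ks ≡⟨ eval-ρMon ks ⟨
    eval h (ρMon ks)                                ∎
    where
    X Yback Yfront : List ℕ → ℕ → List ℕ → ℚ
    X A c C      = xTerms (c ∸ 1) [] (zws (C ++ A))
    Yback A c C  = yTerm (zws (C ++ A ++ c ∷ []))
    Yfront A c C = yTerm (zws (c ∷ C ++ A))

ρ₀-combPoly≈ρComb : ∀ k L → CheckIndexed k L → ρ_ 0 (combPoly L) ≈ ρComb L
ρ₀-combPoly≈ρComb k L L-ok = eval≡⇒≈ {ρ_ 0 (combPoly L)} {ρComb L} λ h →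
  trans (eval-ρ 0 h (combPoly L)) (go h L L-ok)
  where
  go : ∀ h L → CheckIndexed k L → eval (ρ-dual 0 h []) (combPoly L) ≡ eval h (ρComb L)
  go h []              []                          = refl
  go h ((q , ks) ∷ L) ((_ , ks≥1 , _) ∷ L-ok) = begin
    q · ρ-dual 0 h [] (zws ks) ⊹ eval (ρ-dual 0 h []) (combPoly L)
      ≡⟨ cong₂ _⊹_ (cong (q ·_) (ρ-dual₀-zws≡eval-ρMon h ks ks≥1)) (go h L L-ok) ⟩
    q · eval h (ρMon ks) ⊹ eval h (ρComb L)  ≡⟨ cong (_⊹ eval h (ρComb L)) (eval-scale h q (ρMon ks)) ⟨
    eval h (scale q (ρMon ks)) ⊹ eval h (ρComb L) ≡⟨ sumBy-++ _ (scale q (ρMon ks)) (ρComb L) ⟨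
    eval h (ρComb ((q , ks) ∷ L))            ∎

∈ρ₀Ȟ⇔∈ρȞ : ∀ k P → (P ∈ρ[ 0 ]Ȟ k) ⇔ (P ∈ρȞ k)
∈ρ₀Ȟ⇔∈ρȞ k P = mk⇔
  (λ (p , (L , L-ok , p≈L) , P≈ρ₀p) → L , L-ok , λ w →
     trans (P≈ρ₀p w) (trans (ρ-resp-≈ 0 {p} {combPoly L} p≈L w) (ρ₀-combPoly≈ρComb k L L-ok w)))
  (λ (L , L-ok , P≈ρL) → combPoly L , (L , L-ok , λ _ → refl) , λ w →
     trans (P≈ρL w) (sym (ρ₀-combPoly≈ρComb k L L-ok w)))

-- Ȟ¹₁ = 0

¬IsCheckIndex-1 : ∀ ks → ¬ IsCheckIndex 1 ks
¬IsCheckIndex-1 []                    (ks≢[] , _)             = ks≢[] refl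
¬IsCheckIndex-1 (zero ∷ _)            (_ , (() ∷ _) , _)
¬IsCheckIndex-1 (suc zero ∷ [])       (_ , _ , _ , ks≢1s)     = ks≢1s (refl ∷ [])
¬IsCheckIndex-1 (suc zero ∷ zero ∷ _) (_ , (_ ∷ () ∷ _) , _)
¬IsCheckIndex-1 (suc zero ∷ suc _ ∷ _) (_ , _ , () , _)
¬IsCheckIndex-1 (suc (suc _) ∷ _)     (_ , _ , () , _)

∈ρȞ₁⇔≈0 : ∀ n P → (P ∈ρ[ n ]Ȟ 1) ⇔ (P ≈ zeroP)
∈ρȞ₁⇔≈0 n P = mk⇔ to (λ P≈0 → [] , ([] , [] , λ _ → refl) , P≈0)
  where
  to : P ∈ρ[ n ]Ȟ 1 → P ≈ zeroP
  to (p , ([]            , _           , p≈0) , P≈ρp) w = trans (P≈ρp w) (ρ-resp-≈ n {p} {[]} p≈0 w)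
  to (_ , ((_ , ks) ∷ _ , ks-ok ∷ _ , _)   , _)      = ⊥-elim (¬IsCheckIndex-1 ks ks-ok)

-- The three statements hold for every k (with truncated subtraction).
corollary4p6 : (k : ℕ) → 2 ≤ k →
    ((P : Poly) → (P ∈ρ[ k ∸ 2 ]Ȟ 1) ⇔ (P ≈ zeroP))
    × ((j : ℕ) → 1 ≤ j → j + 1 ≤ k ∸ 1 → (P : Poly) →
         P ∈ρ[ k ∸ 1 ∸ j ]Ȟ j → P ∈ρ[ k ∸ 1 ∸ (j + 1) ]Ȟ (j + 1))
    × ((P : Poly) → (P ∈ρ[ 0 ]Ȟ (k ∸ 1)) ⇔ (P ∈ρȞ (k ∸ 1)))
corollary4p6 k _ = ∈ρȞ₁⇔≈0 (k ∸ 2) , step , ∈ρ₀Ȟ⇔∈ρȞ (k ∸ 1)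
  where
  step : (j : ℕ) → 1 ≤ j → j + 1 ≤ k ∸ 1 → (P : Poly) →
         P ∈ρ[ k ∸ 1 ∸ j ]Ȟ j → P ∈ρ[ k ∸ 1 ∸ (j + 1) ]Ȟ (j + 1)
  step j _ j+1≤k-1 P P∈ =
    subst (λ i → P ∈ρ[ k ∸ 1 ∸ i ]Ȟ i) (ℕ.+-comm 1 j)
      (∈ρ-suc⇒∈ρ P (subst (λ n → P ∈ρ[ n ]Ȟ j) (∸≡suc-∸-suc j (k ∸ 1) j<k-1) P∈))
    where
    j<k-1 : suc j ≤ k ∸ 1
    j<k-1 = subst (_≤ k ∸ 1) (ℕ.+-comm j 1) j+1≤k-1
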